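{- Let $K$ be a finite field of characteristic $p$ and order $q$, and let $s$ be a positive integer with $\gcd(s,q-1)=1$. If $p=2$, the cycle type of $\tau$ consists of $|\mathcal{W}_{K,s}|$ instances of $1$. If $p$ is odd, the cycle type of $\tau$ contains no number larger than $(p-1)/2$.
   Context: Let $\zeta=\exp(2\pi i/p)$, $\psi(x)=\zeta^{\mathrm{Tr}(x)}$ with $\mathrm{Tr}\colon K\to\mathbb{F}_p$ the absolute trace, $W_u=\sum_{x\in K}\psi(x^s-ux)$, and $\mathcal{W}_{K,s}=\{W_u: u\in K^\times\}$. Let $\gamma$ be a generator of $\mathbb{F}_p^\times$ and $\sigma\in\mathrm{Gal}(\mathbb{Q}(\zeta)/\mathbb{Q})$ with $\sigma(\zeta)=\zeta^\gamma$; it is known that $\sigma(W_u)=W_{\gamma^{1-1/s}u}$, so $\sigma$ maps $\mathcal{W}_{K,s}$ to itself, and $\tau$ denotes the resulting permutation of $\mathcal{W}_{K,s}$. The cycle type of a permutation is the multiset of lengths of the cycles in its decomposition into disjoint cycles (fixed points counted as cycles of length $1$). -}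

module Defs where

open import Level using (0ℓ)
open import Data.Nat as ℕ using (ℕ; zero; suc)
open import Data.Fin using (Fin; toℕ)
open import Data.List using (List; length; filter)
open import Data.List.Membership.Propositional using (_∈_)
open import Data.List.Relation.Unary.Unique.Propositional using (Unique)
open import Data.Product using (Σ; ∃; _×_)
open import Relation.Nullary using (¬_; Dec)
open import Relation.Binary.PropositionalEquality using (_≡_; _≢_)
import Algebra.Structures as S

record FiniteField : Set₁ where
  infixl 6 _+_ _-_
  infixl 7 _*_
  field
    Carrier : Set
    _+_ _*_ : Carrier → Carrier → Carrier
    -_      : Carrier → Carrier
    0# 1#   : Carrier
    isCommutativeRing : S.IsCommutativeRing {A = Carrier} _≡_ _+_ _*_ -_ 0# 1#
    0≢1     : 0# ≢ 1#
    inverse : ∀ x → x ≢ 0# → Σ Carrier λ y → x * y ≡ 1#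
    _≟_     : (x y : Carrier) → Dec (x ≡ y)
    elements : List Carrier
    complete : ∀ x → x ∈ elements
    unique   : Unique elements

  _-_ : Carrier → Carrier → Carrier
  x - y = x + (- y)

  order : ℕ
  order = length elements

  _^_ : Carrier → ℕ → Carrier
  x ^ zero  = 1#
  x ^ suc n = x * (x ^ n)

  _·_ : ℕ → Carrier → Carrier
  zero  · x = 0#
  suc n · x = x + (n · x)

  -- the absolute trace K → F_p, written as Tr(x) = Σ_{i<n} x^(p^i)
  -- (an element of the prime field of K), where q = p^n
  trace : (p n : ℕ) → Carrier → Carrier
  trace p zero    x = 0#
  trace p (suc n) x = (x ^ (p ℕ.^ n)) + trace p n x

open FiniteField public

-- The cyclotomic integers ℤ[ζ_p] presented as the group ring ℤ[ℤ/p]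
-- modulo the ideal generated by 1 + g + ... + g^(p-1):  an element
-- Σ_j a_j ζ^j is given by its coefficient function a : Fin p → ℕ, and
-- two such elements are equal in ℤ[ζ_p] ⊂ ℚ(ζ) iff their coefficient
-- functions differ by a constant (as integers).

_≈ζ_ : ∀ {p} → (Fin p → ℕ) → (Fin p → ℕ) → Set
_≈ζ_ {p} a b = Σ ℕ λ c → Σ ℕ λ d → ∀ i → a i ℕ.+ c ≡ b i ℕ.+ d

module _ (K : FiniteField) (p n s γ : ℕ) where
  private module K = FiniteField K

  -- σ^k (W_u) = Σ_{x∈K} ζ^(γ^k · Tr(x^s - u x)), as a coefficient function:
  -- the coefficient of ζ^i is #{x ∈ K : γ^k · Tr(x^s - u x) = i in F_p},
  -- the equation in F_p being tested inside the prime field of K.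
  σW : ℕ → K.Carrier → Fin p → ℕ
  σW k u i = length (filter (λ x → ((γ ℕ.^ k) K.· K.trace p n ((x K.^ s) K.- (u K.* x))) K.≟ (toℕ i K.· K.1#)) K.elements)

  -- k is the length of the cycle of τ through W_u:
  -- the least k ≥ 1 with σ^k(W_u) = W_u in ℚ(ζ).
  IsCycleLength : K.Carrier → ℕ → Set
  IsCycleLength u k = 1 ℕ.≤ k × (σW k u ≈ζ σW 0 u)
                    × (∀ j → 1 ℕ.≤ j → j ℕ.< k → ¬ (σW j u ≈ζ σW 0 u))

IsGenerator : ℕ → ℕ → Set
IsGenerator p γ = ∀ a → 1 ℕ.≤ a → a ℕ.< p → ∃ λ k → ∃ λ m → γ ℕ.^ k ≡ a ℕ.+ m ℕ.* p

{-# OPTIONS --safe #-}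
-- Since 0 < γ < p, h = γ · 1 is a non-zero element of the prime field of K, and σᵏ(W_u) arises from
-- W_u by multiplying the trace by hᵏ.  For p = 2 we have γ = 1 and σ is the identity.  For p = 2a + 1,
-- the a + 1 powers h⁰, …, hᵃ fall into the a classes {±c} of 𝔽ₚ^×, so hᵈ = ±1 for some 1 ≤ d ≤ a.
-- Since s (coprime to the even q − 1) and every pⁱ are odd, x ↦ Tr(x^s − u x) is an odd map, so the
-- substitution x ↦ −x absorbs the sign: σᵈ(W_u) = W_u, and the cycle through W_u has length at most d.
module Submission where

open import Defs using (FiniteField; module FiniteField; σW; _≈ζ_; IsCycleLength; IsGenerator)
open import Data.Nat using (ℕ; _≤_; _∸_; _/_)
open import Data.Nat.GCD using (gcd)
open import Data.Nat.Primality using (Prime)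
open import Data.Product using (_×_)
open import Relation.Binary.PropositionalEquality using (_≡_; _≢_)

open import Level using (0ℓ)
open import Data.Nat as ℕ using (zero; suc; s≤s; z≤n; _<_; _≤?_; NonZero)
open import Data.Nat.Properties hiding (_≟_)
open import Data.Nat.DivMod using (_%_; m≡m%n+[m/n]*n; m%n<n; m*n/n≡m)
open import Data.Nat.Divisibility using (_∣_; divides; ∣1⇒≡1)
open import Data.Nat.GCD using (gcd-greatest; module Bézout)
open import Data.Nat.Primality using (prime⇒irreducible; ¬prime[1])
open import Data.Nat.Coprimality using (prime⇒coprime; coprime-Bézout)
open import Data.Nat.Tactic.RingSolver using (solve-∀)
open import Data.Fin as Fin using (Fin; toℕ; fromℕ<)
open import Data.Fin.Properties using (pigeonhole; fromℕ<-injective; toℕ<n)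
open import Data.List using ([]; _∷_; length; filter; map)
open import Data.List.Properties using (length-map; filter-≐)
open import Data.List.Membership.Propositional using (_∈_)
open import Data.List.Membership.Propositional.Properties using (∈-map⁺)
open import Data.List.Membership.Propositional.Properties.WithK using (unique∧set⇒bag)
open import Data.List.Relation.Unary.Unique.Propositional using (Unique)
import Data.List.Relation.Unary.Unique.Propositional.Properties as Unique
open import Data.List.Relation.Binary.BagAndSetEquality using (∼bag⇒↭)
open import Data.List.Relation.Binary.Permutation.Propositional using (_↭_)
open import Data.List.Relation.Binary.Permutation.Propositional.Properties using (filter-↭; ↭-length)
open import Data.Product using (∃; _,_)
open import Data.Sum using (_⊎_; inj₁; inj₂)
open import Data.Empty using (⊥-elim)
open import Function using (_∘_; mk⇔)
open import Relation.Nullary using (yes; no)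
open import Relation.Unary using (Pred; Decidable)
open import Relation.Binary.PropositionalEquality using (refl; sym; trans; cong; cong₂; subst; _≗_; module ≡-Reasoning)
open import Algebra.Bundles using (CommutativeRing)
import Algebra.Properties.Ring as RingProperties
import Algebra.Properties.Semiring.Mult as SemiringMult

Odd : ℕ → Set
Odd m = ∃ λ b → m ≡ suc (b ℕ.* 2)

even⊎odd : ∀ m → (∃ λ b → m ≡ b ℕ.* 2) ⊎ Odd m
even⊎odd zero    = inj₁ (0 , refl)
even⊎odd (suc m) with even⊎odd m
... | inj₁ (b , m≡2b)   = inj₂ (b , cong suc m≡2b)
... | inj₂ (b , m≡2b+1) = inj₁ (suc b , cong suc m≡2b+1)

odd-* : ∀ {m n} → Odd m → Odd n → Odd (m ℕ.* n)
odd-* (b , refl) (c , refl) = c ℕ.+ b ℕ.* suc (c ℕ.* 2) , identity b c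
  where
  identity : ∀ b c → suc (b ℕ.* 2) ℕ.* suc (c ℕ.* 2) ≡ suc ((c ℕ.+ b ℕ.* suc (c ℕ.* 2)) ℕ.* 2)
  identity = solve-∀

odd-^ : ∀ {m} → Odd m → ∀ i → Odd (m ℕ.^ i)
odd-^ odd-m zero    = 0 , refl
odd-^ odd-m (suc i) = odd-* odd-m (odd-^ odd-m i)

prime≢2⇒odd : ∀ {p} → Prime p → p ≢ 2 → Odd p
prime≢2⇒odd {p} p-prime p≢2 with even⊎odd p
... | inj₂ odd-p = odd-p
... | inj₁ (b , p≡2b) with prime⇒irreducible p-prime (divides b p≡2b)
...   | inj₁ ()
...   | inj₂ 2≡p = ⊥-elim (p≢2 (sym 2≡p))

coprime-even⇒odd : ∀ {m} b → gcd m (b ℕ.* 2) ≡ 1 → Odd m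
coprime-even⇒odd {m} b gcd≡1 with even⊎odd m
... | inj₂ odd-m = odd-m
... | inj₁ (c , m≡2c) with ∣1⇒≡1 (subst (2 ∣_) gcd≡1 (gcd-greatest (divides c m≡2c) (divides b refl)))
...   | ()

-- The residues r and 2a + 1 ∸ r, i.e. ±r modulo 2a + 1, share their index.
pairIndex : ℕ → ℕ → ℕ
pairIndex a r with r ≤? a
... | yes _ = r ∸ 1
... | no  _ = a ℕ.* 2 ∸ r

pairIndex< : ∀ a r → 1 ≤ a → r ≤ a ℕ.* 2 → pairIndex a r < a
pairIndex< a r _ _ with r ≤? a
pairIndex< (suc a) r _ _ | yes r≤a = s≤s (∸-monoˡ-≤ 1 r≤a)
pairIndex< a r _ r≤2a    | no  r≰a = begin-strict
  a ℕ.* 2 ∸ r          <⟨ ∸-monoʳ-< (≰⇒> r≰a) r≤2a ⟩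
  a ℕ.* 2 ∸ a          ≡⟨ cong (_∸ a) (*-comm a 2) ⟩
  a ℕ.+ (a ℕ.+ 0) ∸ a  ≡⟨ m+n∸m≡n a (a ℕ.+ 0) ⟩
  a ℕ.+ 0              ≡⟨ +-identityʳ a ⟩
  a                    ∎
  where open ≤-Reasoning

pairIndex-injective : ∀ a x y → 1 ≤ x → 1 ≤ y → x ≤ a ℕ.* 2 → y ≤ a ℕ.* 2
  → pairIndex a x ≡ pairIndex a y → x ≡ y ⊎ x ℕ.+ y ≡ suc (a ℕ.* 2)
pairIndex-injective a x y _ _ _ _ _ with x ≤? a | y ≤? a
pairIndex-injective a (suc x) (suc y) _ _ _ _ eq | yes _ | yes _ = inj₁ (cong suc eq)
pairIndex-injective a x y _ _ x≤2a y≤2a eq | no _ | no _ = inj₁ (∸-cancelˡ-≡ x≤2a y≤2a eq)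
pairIndex-injective a (suc x) y _ _ _ y≤2a eq | yes _ | no _ =
  inj₂ (cong suc (trans (cong (ℕ._+ y) eq) (m∸n+n≡m y≤2a)))
pairIndex-injective a x (suc y) _ _ x≤2a _ eq | no _ | yes _ =
  inj₂ (trans (+-comm x (suc y)) (cong suc (trans (cong (ℕ._+ x) (sym eq)) (m∸n+n≡m x≤2a))))

prime[2a+1]⇒1≤a : ∀ a → Prime (suc (a ℕ.* 2)) → 1 ≤ a
prime[2a+1]⇒1≤a zero    p-prime = ⊥-elim (¬prime[1] p-prime)
prime[2a+1]⇒1≤a (suc a) _       = s≤s z≤n

module _ {ℓ} {A : Set ℓ} where

  filter-map : ∀ {p} {P : Pred A p} (P? : Decidable P) (f : A → A) xs
    → filter P? (map f xs) ≡ map f (filter (P? ∘ f) xs)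
  filter-map P? f []       = refl
  filter-map P? f (x ∷ xs) with P? (f x)
  ... | yes _ = cong (f x ∷_) (filter-map P? f xs)
  ... | no  _ = filter-map P? f xs

  map-involution↭ : ∀ {xs} (f : A → A) → (∀ x → f (f x) ≡ x)
    → Unique xs → (∀ x → x ∈ xs) → map f xs ↭ xs
  map-involution↭ {xs} f involutive unique complete =
    ∼bag⇒↭ (unique∧set⇒bag (Unique.map⁺ injective unique) unique
      λ {x} → mk⇔ (λ _ → complete x) (λ _ → subst (_∈ map f xs) (involutive x) (∈-map⁺ f (complete (f x)))))
    where
    injective : ∀ {x y} → f x ≡ f y → x ≡ y
    injective {x} {y} fx≡fy = trans (sym (involutive x)) (trans (cong f fx≡fy) (involutive y))

  count-∘-involution : ∀ {p} {P : Pred A p} (P? : Decidable P) {xs} (f : A → A)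
    → (∀ x → f (f x) ≡ x) → Unique xs → (∀ x → x ∈ xs)
    → length (filter (P? ∘ f) xs) ≡ length (filter P? xs)
  count-∘-involution P? {xs} f involutive unique complete = begin
    length (filter (P? ∘ f) xs)         ≡⟨ length-map f (filter (P? ∘ f) xs) ⟨
    length (map f (filter (P? ∘ f) xs)) ≡⟨ cong length (filter-map P? f xs) ⟨
    length (filter P? (map f xs))       ≡⟨ ↭-length (filter-↭ P? (map-involution↭ f involutive unique complete)) ⟩
    length (filter P? xs)               ∎
    where open ≡-Reasoning

cycleLength≤period : ∀ K p n s γ u {k d} → IsCycleLength K p n s γ u k
  → 1 ≤ d → σW K p n s γ d u ≈ζ σW K p n s γ 0 u → k ≤ d
cycleLength≤period K p n s γ u {k} {d} (_ , _ , minimal) 1≤d periodic with k ≤? d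
... | yes k≤d = k≤d
... | no  k≰d = ⊥-elim (minimal d 1≤d (≰⇒> k≰d) periodic)

cycleLength[γ≡1] : ∀ K p n s u → IsCycleLength K p n s 1 u 1
cycleLength[γ≡1] K p n s u = ≤-refl , (0 , 0 , λ _ → refl) , λ j 1≤j j<1 → ⊥-elim (<⇒≱ j<1 1≤j)

module FieldProperties (K : FiniteField) where
  open FiniteField K
  open ≡-Reasoning

  commutativeRing : CommutativeRing 0ℓ 0ℓ
  commutativeRing = record
    { Carrier = Carrier ; _≈_ = _≡_ ; _+_ = _+_ ; _*_ = _*_ ; -_ = -_
    ; 0# = 0# ; 1# = 1# ; isCommutativeRing = isCommutativeRing }

  private
    module R = CommutativeRing commutativeRing
  open RingProperties R.ring
    using (-‿distribˡ-*; -‿distribʳ-*; -‿involutive; -‿+-comm; -0#≈0#; +-inverseˡ-unique)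
  open SemiringMult R.semiring using (×-homo-+; ×1-homo-*; ×-assoc-*) renaming (_×_ to _×ᴿ_)

  ·≗× : ∀ n x → n · x ≡ n ×ᴿ x
  ·≗× zero    x = refl
  ·≗× (suc n) x = cong (x +_) (·≗× n x)

  ι : ℕ → Carrier
  ι n = n · 1#

  ι-+ : ∀ m n → ι (m ℕ.+ n) ≡ ι m + ι n
  ι-+ m n = begin
    ι (m ℕ.+ n)        ≡⟨ ·≗× (m ℕ.+ n) 1# ⟩
    (m ℕ.+ n) ×ᴿ 1#    ≡⟨ ×-homo-+ 1# m n ⟩
    m ×ᴿ 1# + n ×ᴿ 1#  ≡⟨ cong₂ _+_ (·≗× m 1#) (·≗× n 1#) ⟨
    ι m + ι n          ∎

  ι-* : ∀ m n → ι (m ℕ.* n) ≡ ι m * ι n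
  ι-* m n = begin
    ι (m ℕ.* n)        ≡⟨ ·≗× (m ℕ.* n) 1# ⟩
    (m ℕ.* n) ×ᴿ 1#    ≡⟨ ×1-homo-* m n ⟩
    m ×ᴿ 1# * n ×ᴿ 1#  ≡⟨ cong₂ _*_ (·≗× m 1#) (·≗× n 1#) ⟨
    ι m * ι n          ∎

  ι-^ : ∀ m i → ι (m ℕ.^ i) ≡ ι m ^ i
  ι-^ m zero    = R.+-identityʳ 1#
  ι-^ m (suc i) = trans (ι-* m (m ℕ.^ i)) (cong (ι m *_) (ι-^ m i))

  ·≡ι* : ∀ n x → n · x ≡ ι n * x
  ·≡ι* n x = begin
    n · x           ≡⟨ ·≗× n x ⟩
    n ×ᴿ x          ≡⟨ cong (n ×ᴿ_) (R.*-identityˡ x) ⟨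
    n ×ᴿ (1# * x)   ≡⟨ ×-assoc-* n 1# x ⟨
    (n ×ᴿ 1#) * x   ≡⟨ cong (_* x) (·≗× n 1#) ⟨
    ι n * x         ∎

  ι-multiple : ∀ {m} → ι m ≡ 0# → ∀ k → ι (k ℕ.* m) ≡ 0#
  ι-multiple {m} ιm≡0 k = trans (ι-* k m) (trans (cong (ι k *_) ιm≡0) (R.zeroʳ (ι k)))

  ι-mod : ∀ {p} .{{_ : NonZero p}} → ι p ≡ 0# → ∀ b → ι b ≡ ι (b % p)
  ι-mod {p} ιp≡0 b = begin
    ι b                                  ≡⟨ cong ι (m≡m%n+[m/n]*n b p) ⟩
    ι (b % p ℕ.+ (b ℕ./ p) ℕ.* p)        ≡⟨ ι-+ (b % p) _ ⟩
    ι (b % p) + ι ((b ℕ./ p) ℕ.* p)      ≡⟨ cong (ι (b % p) +_) (ι-multiple ιp≡0 (b ℕ./ p)) ⟩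
    ι (b % p) + 0#                       ≡⟨ R.+-identityʳ (ι (b % p)) ⟩
    ι (b % p)                            ∎

  ι-zero⇒1+k*m≢l*n : ∀ {m n} → ι m ≡ 0# → ι n ≡ 0# → ∀ k l → 1 ℕ.+ k ℕ.* m ≢ l ℕ.* n
  ι-zero⇒1+k*m≢l*n {m} {n} ιm≡0 ιn≡0 k l eq = 0≢1 (begin
    0#                 ≡⟨ ι-multiple ιn≡0 l ⟨
    ι (l ℕ.* n)        ≡⟨ cong ι eq ⟨
    ι (1 ℕ.+ k ℕ.* m)  ≡⟨ ι-+ 1 (k ℕ.* m) ⟩
    ι 1 + ι (k ℕ.* m)  ≡⟨ cong₂ _+_ (R.+-identityʳ 1#) (ι-multiple ιm≡0 k) ⟩
    1# + 0#            ≡⟨ R.+-identityʳ 1# ⟩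
    1#                 ∎)

  ι-nonzero : ∀ {p γ} → Prime p → ι p ≡ 0# → 1 ≤ γ → γ < p → ι γ ≢ 0#
  ι-nonzero {p} {suc g} p-prime ιp≡0 _ γ<p ιγ≡0 with coprime-Bézout (prime⇒coprime p-prime γ<p)
  ... | Bézout.+- x y 1+yγ≡xp = ι-zero⇒1+k*m≢l*n ιγ≡0 ιp≡0 y x 1+yγ≡xp
  ... | Bézout.-+ x y 1+xp≡yγ = ι-zero⇒1+k*m≢l*n ιp≡0 ιγ≡0 x y 1+xp≡yγ

  ^-+ : ∀ x m n → x ^ (m ℕ.+ n) ≡ x ^ m * x ^ n
  ^-+ x zero    n = sym (R.*-identityˡ (x ^ n))
  ^-+ x (suc m) n = trans (cong (x *_) (^-+ x m n)) (sym (R.*-assoc x (x ^ m) (x ^ n)))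

  *-cancelˡ : ∀ {x} y z → x ≢ 0# → x * y ≡ x * z → y ≡ z
  *-cancelˡ {x} y z x≢0 xy≡xz with inverse x x≢0
  ... | x⁻¹ , xx⁻¹≡1 = begin
    y              ≡⟨ R.*-identityˡ y ⟨
    1# * y         ≡⟨ cong (_* y) x⁻¹x≡1 ⟨
    (x⁻¹ * x) * y  ≡⟨ R.*-assoc x⁻¹ x y ⟩
    x⁻¹ * (x * y)  ≡⟨ cong (x⁻¹ *_) xy≡xz ⟩
    x⁻¹ * (x * z)  ≡⟨ R.*-assoc x⁻¹ x z ⟨
    (x⁻¹ * x) * z  ≡⟨ cong (_* z) x⁻¹x≡1 ⟩
    1# * z         ≡⟨ R.*-identityˡ z ⟩
    z              ∎
    where x⁻¹x≡1 = trans (R.*-comm x⁻¹ x) xx⁻¹≡1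

  *-nonzero : ∀ {x y} → x ≢ 0# → y ≢ 0# → x * y ≢ 0#
  *-nonzero {x} {y} x≢0 y≢0 xy≡0 = y≢0 (*-cancelˡ y 0# x≢0 (trans xy≡0 (sym (R.zeroʳ x))))

  ^-nonzero : ∀ {x} → x ≢ 0# → ∀ i → x ^ i ≢ 0#
  ^-nonzero x≢0 zero    1≡0 = 0≢1 (sym 1≡0)
  ^-nonzero x≢0 (suc i) = *-nonzero x≢0 (^-nonzero x≢0 i)

  -^odd : ∀ x {m} → Odd m → (- x) ^ m ≡ - (x ^ m)
  -^odd x (zero  , refl) = sym (-‿distribˡ-* x 1#)
  -^odd x (suc b , refl) = begin
    - x * (- x * (- x) ^ m)  ≡⟨ cong (λ y → - x * (- x * y)) (-^odd x (b , refl)) ⟩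
    - x * (- x * - (x ^ m))  ≡⟨ cong (- x *_) (-‿distribˡ-* x (- (x ^ m))) ⟨
    - x * - (x * - (x ^ m))  ≡⟨ cong (λ y → - x * - y) (-‿distribʳ-* x (x ^ m)) ⟨
    - x * - - (x * x ^ m)    ≡⟨ cong (- x *_) (-‿involutive (x * x ^ m)) ⟩
    - x * (x * x ^ m)        ≡⟨ -‿distribˡ-* x (x * x ^ m) ⟨
    - (x * (x * x ^ m))      ∎
    where m = suc (b ℕ.* 2)

  trace-‿ : ∀ {p} → Odd p → ∀ n y → trace p n (- y) ≡ - trace p n y
  trace-‿ odd-p zero    y = sym -0#≈0#
  trace-‿ {p} odd-p (suc n) y = begin
    (- y) ^ (p ℕ.^ n) + trace p n (- y)  ≡⟨ cong₂ _+_ (-^odd y (odd-^ odd-p n)) (trace-‿ odd-p n y) ⟩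
    - (y ^ (p ℕ.^ n)) + - trace p n y    ≡⟨ -‿+-comm _ _ ⟩
    - (y ^ (p ℕ.^ n) + trace p n y)      ∎

  ^-∸ : ∀ x {i j} → i ≤ j → x ^ j ≡ x ^ i * x ^ (j ∸ i)
  ^-∸ x {i} {j} i≤j = trans (cong (x ^_) (sym (m+[n∸m]≡n i≤j))) (^-+ x i (j ∸ i))

  ^-cancel± : ∀ {h i j} → i ≤ j → h ≢ 0#
    → h ^ i ≡ h ^ j ⊎ h ^ i + h ^ j ≡ 0#
    → h ^ (j ∸ i) ≡ 1# ⊎ h ^ (j ∸ i) ≡ - 1#
  ^-cancel± {h} {i} {j} i≤j h≢0 (inj₁ hⁱ≡hʲ) = inj₁ (sym (*-cancelˡ 1# (h ^ (j ∸ i)) (^-nonzero h≢0 i) (begin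
    h ^ i * 1#            ≡⟨ R.*-identityʳ (h ^ i) ⟩
    h ^ i                 ≡⟨ hⁱ≡hʲ ⟩
    h ^ j                 ≡⟨ ^-∸ h i≤j ⟩
    h ^ i * h ^ (j ∸ i)   ∎)))
  ^-cancel± {h} {i} {j} i≤j h≢0 (inj₂ hⁱ+hʲ≡0) = inj₂ (+-inverseˡ-unique (h ^ (j ∸ i)) 1#
    (*-cancelˡ (h ^ (j ∸ i) + 1#) 0# (^-nonzero h≢0 i) (begin
      h ^ i * (h ^ (j ∸ i) + 1#)          ≡⟨ R.distribˡ (h ^ i) (h ^ (j ∸ i)) 1# ⟩
      h ^ i * h ^ (j ∸ i) + h ^ i * 1#    ≡⟨ cong₂ _+_ (^-∸ h i≤j) (sym (R.*-identityʳ (h ^ i))) ⟨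
      h ^ j + h ^ i                       ≡⟨ R.+-comm (h ^ j) (h ^ i) ⟩
      h ^ i + h ^ j                       ≡⟨ hⁱ+hʲ≡0 ⟩
      0#                                  ≡⟨ R.zeroʳ (h ^ i) ⟨
      h ^ i * 0#                          ∎)))

  powers-collide : ∀ {a γ} → 1 ≤ a → ι (suc (a ℕ.* 2)) ≡ 0# → ι γ ≢ 0#
    → ∃ λ i → ∃ λ j → i < j × j ≤ a × (ι γ ^ i ≡ ι γ ^ j ⊎ ι γ ^ i + ι γ ^ j ≡ 0#)
  powers-collide {a} {γ} 1≤a ιp≡0 ιγ≢0 = collide (pigeonhole (n<1+n a) index)
    where
    p = suc (a ℕ.* 2)

    residue : ℕ → ℕ
    residue k = γ ℕ.^ k % p

    ι-residue : ∀ k → ι (residue k) ≡ ι γ ^ k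
    ι-residue k = trans (sym (ι-mod ιp≡0 (γ ℕ.^ k))) (ι-^ γ k)

    1≤residue : ∀ k → 1 ≤ residue k
    1≤residue k = n≢0⇒n>0 λ r≡0 → ^-nonzero ιγ≢0 k (trans (sym (ι-residue k)) (cong ι r≡0))

    residue≤2a : ∀ k → residue k ≤ a ℕ.* 2
    residue≤2a k = ≤-pred (m%n<n (γ ℕ.^ k) p)

    index : Fin (suc a) → Fin a
    index i = fromℕ< (pairIndex< a (residue (toℕ i)) 1≤a (residue≤2a (toℕ i)))

    same-index⇒collision : ∀ k l → pairIndex a (residue k) ≡ pairIndex a (residue l)
      → ι γ ^ k ≡ ι γ ^ l ⊎ ι γ ^ k + ι γ ^ l ≡ 0#
    same-index⇒collision k l same-index with pairIndex-injective a (residue k) (residue l)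
      (1≤residue k) (1≤residue l) (residue≤2a k) (residue≤2a l) same-index
    ... | inj₁ rₖ≡rₗ = inj₁ (begin
      ι γ ^ k          ≡⟨ ι-residue k ⟨
      ι (residue k)    ≡⟨ cong ι rₖ≡rₗ ⟩
      ι (residue l)    ≡⟨ ι-residue l ⟩
      ι γ ^ l          ∎)
    ... | inj₂ rₖ+rₗ≡p = inj₂ (begin
      ι γ ^ k + ι γ ^ l                ≡⟨ cong₂ _+_ (ι-residue k) (ι-residue l) ⟨
      ι (residue k) + ι (residue l)    ≡⟨ ι-+ (residue k) (residue l) ⟨
      ι (residue k ℕ.+ residue l)      ≡⟨ cong ι rₖ+rₗ≡p ⟩
      ι p                              ≡⟨ ιp≡0 ⟩
      0#                               ∎)

    collide : (∃ λ i → ∃ λ j → i Fin.< j × index i ≡ index j)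
      → ∃ λ i → ∃ λ j → i < j × j ≤ a × (ι γ ^ i ≡ ι γ ^ j ⊎ ι γ ^ i + ι γ ^ j ≡ 0#)
    collide (i , j , i<j , index-i≡index-j) = toℕ i , toℕ j , i<j , ≤-pred (toℕ<n j) ,
      same-index⇒collision (toℕ i) (toℕ j) (fromℕ<-injective _ _ _ _ index-i≡index-j)

  power≡±1 : ∀ {a γ} → 1 ≤ a → ι (suc (a ℕ.* 2)) ≡ 0# → ι γ ≢ 0#
    → ∃ λ d → 1 ≤ d × d ≤ a × (ι γ ^ d ≡ 1# ⊎ ι γ ^ d ≡ - 1#)
  power≡±1 {a} {γ} 1≤a ιp≡0 ιγ≢0 with powers-collide {a} {γ} 1≤a ιp≡0 ιγ≢0
  ... | i , j , i<j , j≤a , collision =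
    j ∸ i , m<n⇒0<n∸m i<j , ≤-trans (m∸n≤m j i) j≤a , ^-cancel± (<⇒≤ i<j) ιγ≢0 collision

  coefficient : (p n s : ℕ) (c u : Carrier) → Fin p → ℕ
  coefficient p n s c u i = length (filter (λ x → (c * trace p n (x ^ s - u * x)) ≟ ι (toℕ i)) elements)

  σW≗coefficient : ∀ p n s γ k u → σW K p n s γ k u ≗ coefficient p n s (ι γ ^ k) u
  σW≗coefficient p n s γ k u i =
    cong length (filter-≐ _ _ ((λ {x} eq → trans (sym (scale x)) eq) , (λ {x} eq → trans (scale x) eq)) elements)
    where
    scale : ∀ x → (γ ℕ.^ k) · trace p n (x ^ s - u * x) ≡ ι γ ^ k * trace p n (x ^ s - u * x)
    scale x = trans (·≡ι* (γ ℕ.^ k) _) (cong (_* trace p n (x ^ s - u * x)) (ι-^ γ k))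

  coefficient-‿ : ∀ {p s} n → Odd p → Odd s → ∀ c u → coefficient p n s (- c) u ≗ coefficient p n s c u
  coefficient-‿ {p} {s} n odd-p odd-s c u i = trans
    (cong length (filter-≐ _ _ ((λ {x} eq → trans (sym (sign x)) eq) , (λ {x} eq → trans (sign x) eq)) elements))
    (count-∘-involution (λ x → (c * T x) ≟ ι (toℕ i)) -_ -‿involutive unique complete)
    where
    T : Carrier → Carrier
    T x = trace p n (x ^ s - u * x)

    T-odd : ∀ x → T (- x) ≡ - T x
    T-odd x = begin
      trace p n ((- x) ^ s + - (u * - x))  ≡⟨ cong (trace p n) (cong₂ _+_ (-^odd x odd-s) (cong -_ (sym (-‿distribʳ-* u x)))) ⟩
      trace p n (- (x ^ s) + - - (u * x))  ≡⟨ cong (trace p n) (-‿+-comm (x ^ s) (- (u * x))) ⟩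
      trace p n (- (x ^ s - u * x))        ≡⟨ trace-‿ odd-p n (x ^ s - u * x) ⟩
      - T x                                ∎

    sign : ∀ x → - c * T x ≡ c * T (- x)
    sign x = begin
      - c * T x    ≡⟨ -‿distribˡ-* c (T x) ⟨
      - (c * T x)  ≡⟨ -‿distribʳ-* c (T x) ⟩
      c * - T x    ≡⟨ cong (c *_) (T-odd x) ⟨
      c * T (- x)  ∎

  σW-periodic : ∀ {p s} n γ d u → Odd p → Odd s → ι γ ^ d ≡ 1# ⊎ ι γ ^ d ≡ - 1#
    → σW K p n s γ d u ≈ζ σW K p n s γ 0 u
  σW-periodic {p} {s} n γ d u odd-p odd-s hᵈ≡±1 = 0 , 0 , λ i → cong (ℕ._+ 0) (begin
    σW K p n s γ d u i          ≡⟨ σW≗coefficient p n s γ d u i ⟩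
    coefficient p n s (ι γ ^ d) u i  ≡⟨ coefficient≡ hᵈ≡±1 i ⟩
    coefficient p n s 1# u i         ≡⟨ σW≗coefficient p n s γ 0 u i ⟨
    σW K p n s γ 0 u i          ∎)
    where
    coefficient≡ : ι γ ^ d ≡ 1# ⊎ ι γ ^ d ≡ - 1# → coefficient p n s (ι γ ^ d) u ≗ coefficient p n s 1# u
    coefficient≡ (inj₁ hᵈ≡1)  i = cong (λ c → coefficient p n s c u i) hᵈ≡1
    coefficient≡ (inj₂ hᵈ≡-1) i = trans (cong (λ c → coefficient p n s c u i) hᵈ≡-1) (coefficient-‿ n odd-p odd-s 1# u i)

  cycleLength≤half : ∀ a n s γ u {k} → Prime (suc (a ℕ.* 2)) → ι (suc (a ℕ.* 2)) ≡ 0# → Odd s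
    → 1 ≤ γ → γ < suc (a ℕ.* 2) → IsCycleLength K (suc (a ℕ.* 2)) n s γ u k → k ≤ a
  cycleLength≤half a n s γ u p-prime ιp≡0 odd-s 1≤γ γ<p cycle =
    let d , 1≤d , d≤a , hᵈ≡±1 = power≡±1 {a} {γ} (prime[2a+1]⇒1≤a a p-prime) ιp≡0 (ι-nonzero p-prime ιp≡0 1≤γ γ<p)
        periodic = σW-periodic n γ d u (a , refl) odd-s hᵈ≡±1
    in ≤-trans (cycleLength≤period K (suc (a ℕ.* 2)) n s γ u cycle 1≤d periodic) d≤a

open FiniteField using (Carrier; 0#; 1#; _·_; order)

lemma2p4 : (K : FiniteField) (p n s γ : ℕ) → Prime p → _·_ K p (1# K) ≡ 0# K
    → order K ≡ p Data.Nat.^ n → 1 ≤ s → gcd s (order K ∸ 1) ≡ 1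
    → IsGenerator p γ → 1 ≤ γ → γ Data.Nat.< p
    → (p ≡ 2 → ∀ (u : Carrier K) → u ≢ 0# K → IsCycleLength K p n s γ u 1)
      × (p ≢ 2 → ∀ (u : Carrier K) → u ≢ 0# K → ∀ k → IsCycleLength K p n s γ u k → k ≤ (p ∸ 1) / 2)
lemma2p4 K p n s γ p-prime ιp≡0 order≡pⁿ _ gcd≡1 _ 1≤γ γ<p = p≡2⇒trivial , p≢2⇒short
  where
  open FieldProperties K

  p≡2⇒trivial : p ≡ 2 → ∀ u → u ≢ 0# K → IsCycleLength K p n s γ u 1
  p≡2⇒trivial refl u _ rewrite ≤-antisym (≤-pred γ<p) 1≤γ = cycleLength[γ≡1] K 2 n s u

  odd-s : Odd p → Odd s
  odd-s odd-p with odd-^ odd-p n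
  ... | b , pⁿ≡2b+1 = coprime-even⇒odd b (subst (λ q → gcd s (q ∸ 1) ≡ 1) (trans order≡pⁿ pⁿ≡2b+1) gcd≡1)

  p≢2⇒short : p ≢ 2 → ∀ u → u ≢ 0# K → ∀ k → IsCycleLength K p n s γ u k → k ≤ (p ∸ 1) / 2
  p≢2⇒short p≢2 u _ k cycle with prime≢2⇒odd p-prime p≢2
  ... | odd-p@(a , refl) =
    subst (k ≤_) (sym (m*n/n≡m a 2)) (cycleLength≤half a n s γ u p-prime ιp≡0 (odd-s odd-p) 1≤γ γ<p cycle)
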